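{- Let $G$ be a simple connected graph of order $n\ge 3$ and diameter $d$. Then $md(G)\ge f(n,d)$, where $f(n,d)$ is the least positive integer $k$ such that $\frac{(k+d-1)!}{k!\,(d-1)!}+k\ge n$.
   Context: For vertices $u,v$ of a connected graph $G$, $d(u,v)$ is the length of a shortest $u$–$v$ path; the diameter is the maximum distance. For $W\subseteq V(G)$ and $v\in V(G)$, $r_m(v|W)$ is the multiset $\{d(v,w): w\in W\}$. $W$ is an m-resolving set if $r_m(u|W)\neq r_m(v|W)$ for all distinct $u,v\in V(G)$. If $G$ has an m-resolving set, $md(G)$ is the minimum cardinality of one; otherwise $md(G)=\infty$. -}

module Defs where

open import Data.Nat using (ℕ; zero; suc; _+_; _*_; _∸_; _≤_; _<_; _!)
open import Data.Nat.Properties using (_!*_!≢0)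
open import Data.Nat.DivMod using (_/_)
open import Data.Fin using (Fin)
open import Data.Bool using (Bool; true; false)
open import Data.List using (List; map; length)
open import Data.List.Relation.Binary.Permutation.Propositional using (_↭_)
open import Data.Product using (Σ; ∃; _×_; _,_)
open import Relation.Binary.PropositionalEquality using (_≡_; _≢_)
open import Relation.Nullary using (¬_)

record SimpleGraph (n : ℕ) : Set where
  field
    Adj     : Fin n → Fin n → Bool
    symm    : ∀ u v → Adj u v ≡ Adj v u
    irrefl  : ∀ u → Adj u u ≡ false
open SimpleGraph public

data Walk {n : ℕ} (G : SimpleGraph n) : Fin n → Fin n → ℕ → Set where
  here : ∀ {u} → Walk G u u zero
  step : ∀ {u w v k} → Adj G u w ≡ true → Walk G w v k → Walk G u v (suc k)

Connected : ∀ {n} → SimpleGraph n → Set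
Connected G = ∀ u v → ∃ λ k → Walk G u v k

IsDistance : ∀ {n} → SimpleGraph n → Fin n → Fin n → ℕ → Set
IsDistance G u v k = Walk G u v k × (∀ j → Walk G u v j → k ≤ j)

IsDistanceFunction : ∀ {n} → SimpleGraph n → (Fin n → Fin n → ℕ) → Set
IsDistanceFunction G dist = ∀ u v → IsDistance G u v (dist u v)

IsDiameter : ∀ {n} → (Fin n → Fin n → ℕ) → ℕ → Set
IsDiameter dist d = (Σ _ λ u → Σ _ λ v → dist u v ≡ d) × (∀ u v → dist u v ≤ d)

-- r_m(v|W): the multiset of distances from v to the vertices of W,
-- represented as a list; multiset equality is permutation (_↭_).
rm : ∀ {n} → (Fin n → Fin n → ℕ) → Fin n → List (Fin n) → List ℕ
rm dist v W = map (dist v) W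

IsMResolving : ∀ {n} → (Fin n → Fin n → ℕ) → List (Fin n) → Set
IsMResolving dist W = ∀ u v → u ≢ v → ¬ (rm dist u W ↭ rm dist v W)

term : ℕ → ℕ → ℕ
term k d = _/_ ((k + d ∸ 1) !) (k ! * (d ∸ 1) !) {{_!*_!≢0 k (d ∸ 1)}}

IsF : ℕ → ℕ → ℕ → Set
IsF n d k = 1 ≤ k × n ≤ term k d + k × (∀ j → 1 ≤ j → n ≤ term j d + j → k ≤ j)

module Submission where

-- Let W be an m-resolving set and d = b + 1 the diameter (d = 0 is
-- impossible with n ≥ 3 vertices).  Assign to each vertex v a code:
-- v itself if v ∈ W, and otherwise the sorted list of distances r_m(v|W).
-- Because W is m-resolving, the code map is injective.  A vertex outside
-- W has all its distances to W in {1,…,d}, so its code is a nondecreasing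
-- list of length |W| with entries in {1,…,d}; there are C(|W|+d-1, |W|)
-- such lists.  Hence n ≤ C(|W|+d-1, |W|) + |W| = term |W| d + |W|, and
-- minimality of f(n,d) gives f(n,d) ≤ |W| (the case W = [] is excluded
-- since the empty set resolves nothing once n ≥ 2).

open import Defs
open import Data.Nat using (ℕ; zero; suc; _+_; _*_; _∸_; _≤_; _<_; z≤n; s≤s; _!)
open import Data.Nat.Properties
open import Data.Nat.DivMod using (_/_; /-congʳ)
open import Data.Nat.Combinatorics
  using (_C_; nCk≡n!/k![n-k]!; nCn≡1; nCk+nC[k+1]≡[n+1]C[k+1])
open import Data.Fin using (Fin)
import Data.Fin as Fin
import Data.Fin.Properties as FinP
open import Data.List using (List; []; _∷_; length; lookup; map; _++_)
open import Data.List.Properties using (length-map; length-++)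
open import Data.List.Membership.Propositional using (_∈_)
open import Data.List.Membership.Propositional.Properties using (∈-map⁺; ∈-++⁺ˡ; ∈-++⁺ʳ)
import Data.List.Membership.DecPropositional as DecMembership
open import Data.List.Relation.Unary.Any as Any using (here)
open import Data.List.Relation.Unary.Any.Properties using (lookup-index)
open import Data.List.Relation.Unary.All as All using (All; _∷_)
import Data.List.Relation.Unary.All.Properties as All
open import Data.List.Relation.Unary.Linked as Linked using (Linked)
open import Data.List.Relation.Unary.Linked.Properties using (Linked⇒All)
open import Data.List.Relation.Unary.Unique.Propositional using (Unique)
open import Data.List.Relation.Binary.Permutation.Propositional using (_↭_; ↭-sym; ↭-trans)
open import Data.List.Relation.Binary.Permutation.Propositional.Properties using (All-resp-↭; ↭-length)
import Data.List.Sort as Sort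
open import Data.Sum using (_⊎_; inj₁; inj₂)
open import Data.Sum.Properties using (inj₁-injective)
open import Data.Product using (_×_; _,_; proj₁)
open import Data.Empty using (⊥-elim)
open import Function.Definitions using (Injective)
open import Relation.Nullary using (¬_; Dec; yes; no)
open import Relation.Binary.PropositionalEquality

-- Positions in T give an injection
-- Fin n → Fin |T|, since a position determines the element stored there.
injection-into-list : ∀ {A : Set} {n} (f : Fin n → A) → Injective _≡_ _≡_ f →
                      (T : List A) → (∀ v → f v ∈ T) → n ≤ length T
injection-into-list f f-inj T f∈T = FinP.injective⇒≤ position-injective
  where
  position-injective : Injective _≡_ _≡_ (λ v → Any.index (f∈T v))
  position-injective {u} {v} same-index = f-inj (begin
    f u                          ≡⟨ lookup-index (f∈T u) ⟩
    lookup T (Any.index (f∈T u)) ≡⟨ cong (lookup T) same-index ⟩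
    lookup T (Any.index (f∈T v)) ≡⟨ lookup-index (f∈T v) ⟨
    f v                          ∎)
    where open ≡-Reasoning

InWindow : ℕ → ℕ → ℕ → Set
InWindow a b x = a ≤ x × x ≤ a + b

-- All nondecreasing lists of length m with entries in the window
-- {a,…,a+b}: either the list starts with a (and continues inside the same
-- window), or no entry equals a (and the window shrinks to {a+1,…,a+b}).
sortedLists : (m a b : ℕ) → List (List ℕ)
sortedLists zero    a b       = [] ∷ []
sortedLists (suc m) a zero    = map (a ∷_) (sortedLists m a zero)
sortedLists (suc m) a (suc b) =
  map (a ∷_) (sortedLists m a (suc b)) ++ sortedLists (suc m) (suc a) b

length-sortedLists : ∀ m a b → length (sortedLists m a b) ≡ (m + b) C m
length-sortedLists zero    a b    = refl
length-sortedLists (suc m) a zero = begin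
  length (map (a ∷_) (sortedLists m a zero)) ≡⟨ length-map (a ∷_) (sortedLists m a zero) ⟩
  length (sortedLists m a zero)              ≡⟨ length-sortedLists m a zero ⟩
  (m + 0) C m                                ≡⟨ cong (_C m) (+-identityʳ m) ⟩
  m C m                                      ≡⟨ trans (nCn≡1 m) (sym (nCn≡1 (suc m))) ⟩
  suc m C suc m                              ≡⟨ cong (_C suc m) (+-identityʳ (suc m)) ⟨
  (suc m + 0) C suc m                        ∎
  where open ≡-Reasoning
length-sortedLists (suc m) a (suc b) = begin
  length (map (a ∷_) (sortedLists m a (suc b)) ++ sortedLists (suc m) (suc a) b)
    ≡⟨ length-++ (map (a ∷_) (sortedLists m a (suc b))) ⟩
  length (map (a ∷_) (sortedLists m a (suc b))) + length (sortedLists (suc m) (suc a) b)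
    ≡⟨ cong₂ _+_ (trans (length-map (a ∷_) (sortedLists m a (suc b))) (length-sortedLists m a (suc b)))
                 (length-sortedLists (suc m) (suc a) b) ⟩
  (m + suc b) C m + (suc m + b) C suc m
    ≡⟨ cong (λ t → (m + suc b) C m + t C suc m) (+-suc m b) ⟨
  (m + suc b) C m + (m + suc b) C suc m
    ≡⟨ nCk+nC[k+1]≡[n+1]C[k+1] (m + suc b) m ⟩
  (suc m + suc b) C suc m ∎
  where open ≡-Reasoning

narrow-window : ∀ {a b x xs} → a < x → Linked _≤_ (x ∷ xs) →
                All (InWindow a (suc b)) (x ∷ xs) → All (InWindow (suc a) b) (x ∷ xs)
narrow-window {a} {b} a<x sorted inWindow =
  All.zipWith (λ (above-a , (_ , below)) → above-a , ≤-trans below (≤-reflexive (+-suc a b)))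
              (Linked⇒All ≤-trans a<x sorted , inWindow)

∈-sortedLists : ∀ m a b xs → Linked _≤_ xs → length xs ≡ m →
                All (InWindow a b) xs → xs ∈ sortedLists m a b
∈-sortedLists zero a b [] _ _ _ = here refl
∈-sortedLists (suc m) a zero (x ∷ xs) sorted len ((a≤x , x≤a+0) ∷ inWindow) =
  subst (λ y → y ∷ xs ∈ sortedLists (suc m) a zero) a≡x
    (∈-map⁺ (a ∷_) (∈-sortedLists m a zero xs (Linked.tail sorted) (suc-injective len) inWindow))
  where
  a≡x : a ≡ x
  a≡x = ≤-antisym a≤x (subst (x ≤_) (+-identityʳ a) x≤a+0)
∈-sortedLists (suc m) a (suc b) (x ∷ xs) sorted len ((a≤x , x≤a+b+1) ∷ inWindow)
  with m≤n⇒m<n∨m≡n a≤x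
... | inj₂ a≡x = subst (λ y → y ∷ xs ∈ sortedLists (suc m) a (suc b)) a≡x
      (∈-++⁺ˡ (∈-map⁺ (a ∷_)
        (∈-sortedLists m a (suc b) xs (Linked.tail sorted) (suc-injective len) inWindow)))
... | inj₁ a<x  = ∈-++⁺ʳ (map (a ∷_) (sortedLists m a (suc b)))
      (∈-sortedLists (suc m) (suc a) b (x ∷ xs) sorted len
        (narrow-window a<x sorted ((a≤x , x≤a+b+1) ∷ inWindow)))

term≡binomial : ∀ m b → term m (suc b) ≡ (m + b) C m
term≡binomial m b rewrite +-suc m b = sym (begin
  (m + b) C m                                 ≡⟨ nCk≡n!/k![n-k]! (m≤m+n m b) ⟩
  ((m + b) ! / (m ! * (m + b ∸ m) !)) {{_}}   ≡⟨ /-congʳ {{m !* (m + b ∸ m) !≢0}} {{m !* b !≢0}}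
                                                   (cong (λ c → m ! * c !) (m+n∸m≡n m b)) ⟩
  ((m + b) ! / (m ! * b !)) {{_}}             ∎)
  where open ≡-Reasoning

walk-of-length-zero : ∀ {n} {G : SimpleGraph n} {u v} → Walk G u v 0 → u ≡ v
walk-of-length-zero here = refl

distance-positive : ∀ {n} {G : SimpleGraph n} {dist} → IsDistanceFunction G dist →
                    ∀ {u v} → u ≢ v → 1 ≤ dist u v
distance-positive {dist = dist} isDist {u} {v} u≢v with dist u v | proj₁ (isDist u v)
... | zero  | walk = ⊥-elim (u≢v (walk-of-length-zero walk))
... | suc _ | _    = s≤s z≤n

open Sort ≤-decTotalOrder using (sort; sort-↭; sort-↗)

-- Sorting is a canonical form for multisets: equal sorts mean equal multisets.
sort-reflects-↭ : ∀ xs ys → sort xs ≡ sort ys → xs ↭ ys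
sort-reflects-↭ xs ys same-sort =
  ↭-trans (↭-sym (sort-↭ xs)) (subst (_↭ ys) (sym same-sort) (sort-↭ ys))

module ResolvingCode {n} (dist : Fin n → Fin n → ℕ) (W : List (Fin n)) where

  open DecMembership (FinP._≟_ {n}) using (_∈?_)

  Code : Set
  Code = List ℕ ⊎ Fin n

  codeFrom : ∀ v → Dec (v ∈ W) → Code
  codeFrom v (yes _) = inj₂ v
  codeFrom v (no _)  = inj₁ (sort (rm dist v W))

  code : Fin n → Code
  code v = codeFrom v (v ∈? W)

  code-injective : IsMResolving dist W → Injective _≡_ _≡_ code
  code-injective resolving {u} {v} = injective (u ∈? W) (v ∈? W)
    where
    injective : (u∈?W : Dec (u ∈ W)) (v∈?W : Dec (v ∈ W)) →
                codeFrom u u∈?W ≡ codeFrom v v∈?W → u ≡ v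
    injective (yes _) (yes _) refl = refl
    injective (no _)  (no _)  same-code with u FinP.≟ v
    ... | yes u≡v = u≡v
    ... | no u≢v  = ⊥-elim (resolving u v u≢v
                      (sort-reflects-↭ (rm dist u W) (rm dist v W) (inj₁-injective same-code)))

  candidates : ℕ → List Code
  candidates b = map inj₁ (sortedLists (length W) 1 b) ++ map inj₂ W

  length-candidates : ∀ b → length (candidates b) ≡ (length W + b) C length W + length W
  length-candidates b = begin
    length (map inj₁ (sortedLists (length W) 1 b) ++ map inj₂ W)
      ≡⟨ length-++ (map inj₁ (sortedLists (length W) 1 b)) ⟩
    length (map inj₁ (sortedLists (length W) 1 b)) + length (map inj₂ W)
      ≡⟨ cong₂ _+_ (trans (length-map inj₁ (sortedLists (length W) 1 b))
                          (length-sortedLists (length W) 1 b))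
                   (length-map inj₂ W) ⟩
    (length W + b) C length W + length W ∎
    where open ≡-Reasoning

  -- Every code is a candidate: outside W the distances to W are
  -- positive and bounded by the diameter b + 1.
  code∈candidates : ∀ {G : SimpleGraph n} {b} → IsDistanceFunction G dist →
                    (∀ u v → dist u v ≤ suc b) → ∀ v → code v ∈ candidates b
  code∈candidates {b = b} isDist bounded v = codeFrom∈ (v ∈? W)
    where
    distances-in-window : ¬ (v ∈ W) → All (InWindow 1 b) (rm dist v W)
    distances-in-window v∉W = All.map⁺ (All.tabulate (λ {w} w∈W →
      distance-positive isDist (λ v≡w → v∉W (subst (_∈ W) (sym v≡w) w∈W)) , bounded v w))

    codeFrom∈ : (v∈?W : Dec (v ∈ W)) → codeFrom v v∈?W ∈ candidates b
    codeFrom∈ (yes v∈W) = ∈-++⁺ʳ (map inj₁ (sortedLists (length W) 1 b)) (∈-map⁺ inj₂ v∈W)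
    codeFrom∈ (no v∉W)  = ∈-++⁺ˡ (∈-map⁺ inj₁ (∈-sortedLists (length W) 1 b (sort (rm dist v W))
      (sort-↗ (rm dist v W))
      (trans (↭-length (sort-↭ (rm dist v W))) (length-map (dist v) W))
      (All-resp-↭ (↭-sym (sort-↭ (rm dist v W))) (distances-in-window v∉W))))

resolving-set-bound : ∀ {n} {G : SimpleGraph n} {dist} → IsDistanceFunction G dist →
                      ∀ {b} → (∀ u v → dist u v ≤ suc b) →
                      ∀ {W} → IsMResolving dist W → n ≤ (length W + b) C length W + length W
resolving-set-bound {dist = dist} isDist {b} bounded {W} resolving =
  subst (_ ≤_) (length-candidates b)
    (injection-into-list code (code-injective resolving) (candidates b)
      (code∈candidates isDist bounded))
  where open ResolvingCode dist W

-- With n ≥ 3 the diameter is positive (vertices 0 and 1 are distinct)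
-- and W is nonempty (the empty set gives all vertices the same multiset),
-- so the counting bound and minimality of f(n,d) apply.
theorem2p8 : (n : ℕ) → 3 ≤ n → (G : SimpleGraph n) → Connected G →
    (dist : Fin n → Fin n → ℕ) → IsDistanceFunction G dist →
    (d : ℕ) → IsDiameter dist d →
    (k : ℕ) → IsF n d k →
    (W : List (Fin n)) → Unique W → IsMResolving dist W →
    k ≤ length W
theorem2p8 _ (s≤s (s≤s (s≤s _))) _ _ _ isDist zero (_ , bounded) _ _ _ _ _ =
  ⊥-elim (1+n≰n (≤-trans (distance-positive isDist (λ ())) (bounded Fin.zero (Fin.suc Fin.zero))))
theorem2p8 _ (s≤s (s≤s (s≤s _))) _ _ _ _ (suc _) _ _ _ [] _ resolving =
  ⊥-elim (resolving Fin.zero (Fin.suc Fin.zero) (λ ()) _↭_.refl)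
theorem2p8 n _ _ _ _ isDist (suc b) (_ , bounded) k (_ , _ , least) W@(_ ∷ _) _ resolving =
  least (length W) (s≤s z≤n)
    (subst (λ t → n ≤ t + length W) (sym (term≡binomial (length W) b))
      (resolving-set-bound isDist bounded resolving))
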